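{- Let $n\ge1$ and let $G$ be the sibling tree $ST_n$. Then every minimum locating-total dominating set of $G$ contains at least $2^{n}$ vertices from levels $n-1$ and $n$.
   Context: The sibling tree $ST_n$ has vertex set $\{1,\dots,2^{n+1}-1\}$; its edges are the complete binary tree edges $\{x,2x\},\{x,2x+1\}$ for $1\le x\le 2^n-1$ together with the sibling edges $\{2x,2x+1\}$ for $1\le x\le 2^n-1$. The root $1$ is at level $0$ and vertex $v$ is at level $i$ iff $2^i\le v\le 2^{i+1}-1$. A locating-total dominating set is a set $S$ such that every vertex of $G$ has a neighbor in $S$ and distinct $u,v\notin S$ satisfy $N(u)\cap S\ne N(v)\cap S$ (open neighborhoods); a minimum one is one of least cardinality. -}

module Defs where

open import Data.Nat using (ℕ; zero; suc; _+_; _*_; _∸_; _^_; _≤_; _<_; _≤?_; _<?_)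
open import Data.Product using (_×_; Σ; _,_)
open import Data.Sum using (_⊎_)
open import Data.List using (List; length; filter)
open import Data.List.Membership.Propositional using (_∈_; _∉_)
open import Data.List.Relation.Unary.All using (All)
open import Data.List.Relation.Unary.Unique.Propositional using (Unique)
open import Relation.Binary.PropositionalEquality using (_≡_; _≢_)
open import Relation.Nullary using (¬_; Dec)
open import Relation.Nullary.Decidable using (_×-dec_; _⊎-dec_)
open import Function.Bundles using (_⇔_)

Vertex : ℕ → ℕ → Set
Vertex n v = 1 ≤ v × v < 2 ^ (suc n)

data Edge (n : ℕ) : ℕ → ℕ → Set where
  left  : ∀ x → 1 ≤ x → x < 2 ^ n → Edge n x (2 * x)
  right : ∀ x → 1 ≤ x → x < 2 ^ n → Edge n x (suc (2 * x))
  sibling : ∀ x → 1 ≤ x → x < 2 ^ n → Edge n (2 * x) (suc (2 * x))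

Adj : ℕ → ℕ → ℕ → Set
Adj n u v = Edge n u v ⊎ Edge n v u

-- Finite vertex sets are represented by duplicate-free lists of vertices.
-- Locating-total dominating set of ST_n.
record IsLTD (n : ℕ) (S : List ℕ) : Set where
  field
    subset    : All (Vertex n) S
    total     : ∀ v → Vertex n v → Σ ℕ (λ u → u ∈ S × Adj n v u)
    locating  : ∀ u v → Vertex n u → Vertex n v → u ≢ v → u ∉ S → v ∉ S →
                ¬ (∀ w → w ∈ S → (Adj n u w ⇔ Adj n v w))

record IsMinLTD (n : ℕ) (S : List ℕ) : Set where
  field
    unique  : Unique S
    isLTD   : IsLTD n S
    minimal : ∀ T → Unique T → IsLTD n T → length S ≤ length T

InLevel : ℕ → ℕ → Set
InLevel i v = 2 ^ i ≤ v × v < 2 ^ (suc i)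

inLevel? : ∀ i v → Dec (InLevel i v)
inLevel? i v = (2 ^ i ≤? v) ×-dec (v <? 2 ^ (suc i))

countLevels : ℕ → List ℕ → ℕ
countLevels n S = length (filter (λ v → inLevel? (n ∸ 1) v ⊎-dec inLevel? n v) S)

module Submission where

-- Write n = m + 1, so levels n-1 and n are the levels m and
-- m + 1 of ST_n.  For a vertex x on level m call {x, 2x, 2x+1} the family
-- of x.  The leaves 2x and 2x+1 have exactly two neighbours each: their
-- parent x and each other.  Hence every locating-total dominating set S
-- contains two distinct members of every family: if S misses both leaves
-- they have the same trace {x} ∩ S (violating the locating condition), and
-- if S contains exactly one leaf, that leaf is dominated only through x.
-- Families of different level-m vertices are disjoint and lie in levels m
-- and m + 1, so the 2^m families contribute 2 · 2^m = 2^n distinct members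
-- of S on these levels.

open import Defs
open import Data.Nat using (ℕ; zero; suc; _+_; _*_; _^_; _≤_; _<_; z≤n; s≤s)
open import Data.Nat.Properties
open import Data.List using (List; []; _∷_; length; filter)
open import Data.List.Membership.Propositional using (_∈_; _∉_)
open import Data.List.Membership.Propositional.Properties using (∈-filter⁺)
open import Data.List.Membership.DecPropositional _≟_ using (_∈?_)
open import Data.List.Relation.Binary.Subset.Propositional using (_⊆_)
open import Data.List.Relation.Unary.Any using (here; there)
open import Data.List.Relation.Unary.All as All using (All; []; _∷_)
open import Data.List.Relation.Unary.AllPairs using ([]; _∷_)
open import Data.List.Relation.Unary.Unique.Propositional using (Unique)
open import Data.Product using (Σ; _×_; _,_; proj₁; proj₂)
open import Data.Sum using (_⊎_; inj₁; inj₂)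
open import Data.Empty using (⊥; ⊥-elim)
open import Relation.Nullary using (¬_; yes; no)
open import Relation.Nullary.Decidable using (_⊎-dec_)
open import Relation.Binary.PropositionalEquality
open import Function.Base using (_∘_)
open import Function.Bundles using (_⇔_; mk⇔)

double-injective : ∀ y x → 2 * y ≡ 2 * x → y ≡ x
double-injective y x = *-cancelˡ-≡ y x 2

odd<double : ∀ {x X} → x < X → suc (2 * x) < 2 * X
odd<double {x} {X} x<X = subst (_≤ 2 * X) (*-suc 2 x) (*-monoʳ-≤ 2 x<X)

even-child-level : ∀ {m x} → InLevel m x → InLevel (suc m) (2 * x)
even-child-level (lo , hi) = *-monoʳ-≤ 2 lo , <-trans (n<1+n _) (odd<double hi)

odd-child-level : ∀ {m x} → InLevel m x → InLevel (suc m) (suc (2 * x))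
odd-child-level (lo , hi) = m≤n⇒m≤1+n (*-monoʳ-≤ 2 lo) , odd<double hi

level⇒vertex : ∀ {i v} → InLevel i v → Vertex i v
level⇒vertex {i} (lo , hi) = ≤-trans (m^n>0 2 i) lo , hi

edge-from-leaf : ∀ {n u w} → Edge n u w → 2 ^ n ≤ u →
                 Σ ℕ λ y → u ≡ 2 * y × w ≡ suc (2 * y)
edge-from-leaf (left x _ x<2ⁿ)  2ⁿ≤x = ⊥-elim (<⇒≱ x<2ⁿ 2ⁿ≤x)
edge-from-leaf (right x _ x<2ⁿ) 2ⁿ≤x = ⊥-elim (<⇒≱ x<2ⁿ 2ⁿ≤x)
edge-from-leaf (sibling x _ _)  _    = x , refl , refl

edge-into-even : ∀ {n w u x} → Edge n w u → u ≡ 2 * x → w ≡ x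
edge-into-even {x = x} (left y _ _)    eq = double-injective y x eq
edge-into-even {x = x} (right y _ _)   eq = ⊥-elim (even≢odd x y (sym eq))
edge-into-even {x = x} (sibling y _ _) eq = ⊥-elim (even≢odd x y (sym eq))

edge-into-odd : ∀ {n w u x} → Edge n w u → u ≡ suc (2 * x) → w ≡ x ⊎ w ≡ 2 * x
edge-into-odd {x = x} (left y _ _)    eq = ⊥-elim (even≢odd y x eq)
edge-into-odd {x = x} (right y _ _)   eq = inj₁ (double-injective y x (suc-injective eq))
edge-into-odd {x = x} (sibling y _ _) eq = inj₂ (cong (2 *_) (double-injective y x (suc-injective eq)))

even-leaf-neighbour : ∀ {n w} x → Adj n (2 * x) w → 2 ^ n ≤ 2 * x → w ≡ x ⊎ w ≡ suc (2 * x)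
even-leaf-neighbour x (inj₁ e) 2ⁿ≤2x with y , 2x≡2y , refl ← edge-from-leaf e 2ⁿ≤2x =
  inj₂ (cong (λ z → suc (2 * z)) (sym (double-injective x y 2x≡2y)))
even-leaf-neighbour x (inj₂ e) _ = inj₁ (edge-into-even e refl)

odd-leaf-neighbour : ∀ {n w} x → Adj n (suc (2 * x)) w → 2 ^ n ≤ 2 * x → w ≡ x ⊎ w ≡ 2 * x
odd-leaf-neighbour x (inj₁ e) 2ⁿ≤2x with y , 2x+1≡2y , _ ← edge-from-leaf e (m≤n⇒m≤1+n 2ⁿ≤2x) =
  ⊥-elim (even≢odd y x (sym 2x+1≡2y))
odd-leaf-neighbour x (inj₂ e) _ = edge-into-odd e refl

delete-member : ∀ {a : ℕ} {M} → a ∈ M →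
                Σ (List ℕ) λ M′ → length M ≡ suc (length M′) × (∀ {v} → v ∈ M → v ≢ a → v ∈ M′)
delete-member {a} {_ ∷ M} (here refl) = M , refl , keep
  where
    keep : ∀ {v} → v ∈ a ∷ M → v ≢ a → v ∈ M
    keep (here refl) v≢a = ⊥-elim (v≢a refl)
    keep (there v∈M) _   = v∈M
delete-member {a} {y ∷ M} (there a∈M) with M′ , len , keep ← delete-member a∈M =
  y ∷ M′ , cong suc len , keep′
  where
    keep′ : ∀ {v} → v ∈ y ∷ M → v ≢ a → v ∈ y ∷ M′
    keep′ (here refl) _   = here refl
    keep′ (there v∈M) v≢a = there (keep v∈M v≢a)

unique-subset-length : ∀ {L M : List ℕ} → Unique L → L ⊆ M → length L ≤ length M
unique-subset-length {[]} _ _ = z≤n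
unique-subset-length {a ∷ L} (a∉L ∷ L-unique) L⊆M
  with M′ , len , keep ← delete-member (L⊆M (here refl)) rewrite len =
  s≤s (unique-subset-length L-unique
        (λ v∈L → keep (L⊆M (there v∈L)) (≢-sym (All.lookup a∉L v∈L))))

Family : ℕ → ℕ → Set
Family x a = a ≡ x ⊎ a ≡ 2 * x ⊎ a ≡ suc (2 * x)

TwoInFamily : List ℕ → ℕ → Set
TwoInFamily S x = Σ ℕ λ a → Σ ℕ λ b → a ≢ b × a ∈ S × b ∈ S × Family x a × Family x b

module _ {m : ℕ} where

  -- v is not available for the family of x: it is below x, or it is a
  -- child of a level-m vertex below x.
  Covered : ℕ → ℕ → Set
  Covered x v = v < x ⊎ (2 ^ suc m ≤ v × v < 2 * x)

  covered-next : ∀ {x v} → Covered x v → Covered (suc x) v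
  covered-next (inj₁ v<x)             = inj₁ (m<n⇒m<1+n v<x)
  covered-next {x} (inj₂ (2ⁿ≤v , v<2x)) = inj₂ (2ⁿ≤v , <-≤-trans v<2x (*-monoʳ-≤ 2 (n≤1+n x)))

  module _ {x : ℕ} (x∈level : InLevel m x) where
    private
      even-child : InLevel (suc m) (2 * x)
      even-child = even-child-level {m} {x} x∈level

      odd-child : InLevel (suc m) (suc (2 * x))
      odd-child = odd-child-level {m} {x} x∈level

      2ⁿ≤2x : 2 ^ suc m ≤ 2 * x
      2ⁿ≤2x = proj₁ even-child

      1≤x : 1 ≤ x
      1≤x = ≤-trans (m^n>0 2 m) (proj₁ x∈level)

      x<2ⁿ : x < 2 ^ suc m
      x<2ⁿ = proj₂ x∈level

    family-uncovered : ∀ {a} → Family x a → ¬ Covered x a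
    family-uncovered (inj₁ refl)        (inj₁ x<x)          = <-irrefl refl x<x
    family-uncovered (inj₁ refl)        (inj₂ (2ⁿ≤x , _))   = <⇒≱ x<2ⁿ 2ⁿ≤x
    family-uncovered (inj₂ (inj₁ refl)) (inj₁ 2x<x)         = <⇒≱ 2x<x (m≤n*m x 2)
    family-uncovered (inj₂ (inj₁ refl)) (inj₂ (_ , 2x<2x))  = <-irrefl refl 2x<2x
    family-uncovered (inj₂ (inj₂ refl)) (inj₁ 2x+1<x)       = <⇒≱ 2x+1<x (m≤n⇒m≤1+n (m≤n*m x 2))
    family-uncovered (inj₂ (inj₂ refl)) (inj₂ (_ , 2x+1<2x)) = <⇒≱ 2x+1<2x (n≤1+n _)

    family-covered-next : ∀ {a} → Family x a → Covered (suc x) a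
    family-covered-next (inj₁ refl)        = inj₁ (n<1+n x)
    family-covered-next (inj₂ (inj₁ refl)) = inj₂ (proj₁ even-child , *-monoʳ-< 2 (n<1+n x))
    family-covered-next (inj₂ (inj₂ refl)) = inj₂ (proj₁ odd-child , odd<double (n<1+n x))

    family-levels : ∀ {a} → Family x a → InLevel m a ⊎ InLevel (suc m) a
    family-levels (inj₁ refl)        = inj₁ x∈level
    family-levels (inj₂ (inj₁ refl)) = inj₂ even-child
    family-levels (inj₂ (inj₂ refl)) = inj₂ odd-child

    module _ {S : List ℕ} (ltd : IsLTD (suc m) S) where
      open IsLTD ltd

      -- If S contains neither leaf, both leaves see only x in S: not locating.
      some-leaf-in-set : 2 * x ∉ S → suc (2 * x) ∉ S → ⊥
      some-leaf-in-set even∉S odd∉S =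
        locating (2 * x) (suc (2 * x))
          (level⇒vertex {suc m} even-child) (level⇒vertex {suc m} odd-child)
          (even≢odd x x) even∉S odd∉S same-trace
        where
          same-trace : ∀ w → w ∈ S → (Adj (suc m) (2 * x) w ⇔ Adj (suc m) (suc (2 * x)) w)
          same-trace w w∈S = mk⇔ even⇒odd odd⇒even
            where
              even⇒odd : Adj (suc m) (2 * x) w → Adj (suc m) (suc (2 * x)) w
              even⇒odd adj with even-leaf-neighbour x adj 2ⁿ≤2x
              ... | inj₁ refl = inj₂ (right x 1≤x x<2ⁿ)
              ... | inj₂ refl = ⊥-elim (odd∉S w∈S)
              odd⇒even : Adj (suc m) (suc (2 * x)) w → Adj (suc m) (2 * x) w
              odd⇒even adj with odd-leaf-neighbour x adj 2ⁿ≤2x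
              ... | inj₁ refl = inj₂ (left x 1≤x x<2ⁿ)
              ... | inj₂ refl = ⊥-elim (even∉S w∈S)

      -- A leaf whose sibling is missing from S can only be dominated by x.
      parent-dominates-even : suc (2 * x) ∉ S → x ∈ S
      parent-dominates-even odd∉S
        with u , u∈S , adj ← total (2 * x) (level⇒vertex {suc m} even-child)
        with even-leaf-neighbour x adj 2ⁿ≤2x
      ... | inj₁ refl = u∈S
      ... | inj₂ refl = ⊥-elim (odd∉S u∈S)

      parent-dominates-odd : 2 * x ∉ S → x ∈ S
      parent-dominates-odd even∉S
        with u , u∈S , adj ← total (suc (2 * x)) (level⇒vertex {suc m} odd-child)
        with odd-leaf-neighbour x adj 2ⁿ≤2x
      ... | inj₁ refl = u∈S
      ... | inj₂ refl = ⊥-elim (even∉S u∈S)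

      two-in-family : TwoInFamily S x
      two-in-family with 2 * x ∈? S | suc (2 * x) ∈? S
      ... | yes even∈S | yes odd∈S =
        2 * x , suc (2 * x) , even≢odd x x , even∈S , odd∈S , inj₂ (inj₁ refl) , inj₂ (inj₂ refl)
      ... | yes even∈S | no odd∉S =
        x , 2 * x , <⇒≢ (<-≤-trans x<2ⁿ 2ⁿ≤2x) , parent-dominates-even odd∉S , even∈S
          , inj₁ refl , inj₂ (inj₁ refl)
      ... | no even∉S | yes odd∈S =
        x , suc (2 * x) , <⇒≢ (<-≤-trans x<2ⁿ (m≤n⇒m≤1+n 2ⁿ≤2x)) , parent-dominates-odd even∉S , odd∈S
          , inj₁ refl , inj₂ (inj₂ refl)
      ... | no even∉S | no odd∉S = ⊥-elim (some-leaf-in-set even∉S odd∉S)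

  offset-in-level : ∀ {k} → k < 2 ^ m → InLevel m (2 ^ m + k)
  offset-in-level {k} k<2ᵐ =
    m≤m+n (2 ^ m) k , +-monoʳ-< (2 ^ m) (subst (k <_) (sym (+-identityʳ (2 ^ m))) k<2ᵐ)

  module _ {S : List ℕ} (ltd : IsLTD (suc m) S) where

    S-bottom : List ℕ
    S-bottom = filter (λ v → inLevel? m v ⊎-dec inLevel? (suc m) v) S

    Collection : ℕ → ℕ → Set
    Collection x c =
      Σ (List ℕ) λ L → length L ≡ c × Unique L × L ⊆ S-bottom × All (Covered x) L

    extend : ∀ {x c} → InLevel m x → Collection x c → Collection (suc x) (2 + c)
    extend {x} x∈level (L , len , L-unique , L⊆S , L-covered)
      with a , b , a≢b , a∈S , b∈S , a-family , b-family ← two-in-family x∈level ltd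
      = a ∷ b ∷ L
      , cong (suc ∘ suc) len
      , (a≢b ∷ fresh a-family) ∷ fresh b-family ∷ L-unique
      , grow
      , family-covered-next x∈level a-family ∷ family-covered-next x∈level b-family
          ∷ All.map covered-next L-covered
      where
        fresh : ∀ {c} → Family x c → All (c ≢_) L
        fresh c-family = All.map (λ v-covered c≡v →
          family-uncovered x∈level c-family (subst (Covered x) (sym c≡v) v-covered)) L-covered

        grow : a ∷ b ∷ L ⊆ S-bottom
        grow (here refl)         = ∈-filter⁺ _ a∈S (family-levels x∈level a-family)
        grow (there (here refl)) = ∈-filter⁺ _ b∈S (family-levels x∈level b-family)
        grow (there (there v∈L)) = L⊆S v∈L

    collect : ∀ k → k ≤ 2 ^ m → Collection (2 ^ m + k) (2 * k)
    collect zero    _     = [] , refl , [] , (λ ()) , []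
    collect (suc k) k<2ᵐ  = subst₂ Collection (sym (+-suc (2 ^ m) k)) (sym (*-suc 2 k))
      (extend (offset-in-level k<2ᵐ) (collect k (<⇒≤ k<2ᵐ)))

    bottom-count : 2 ^ suc m ≤ length S-bottom
    bottom-count with L , len , L-unique , L⊆S , _ ← collect (2 ^ m) ≤-refl =
      subst (_≤ length S-bottom) len (unique-subset-length L-unique L⊆S)

lemma13 : ∀ (n : ℕ) → 1 ≤ n → (S : List ℕ) → IsMinLTD n S → 2 ^ n ≤ countLevels n S
lemma13 (suc m) _ S S-min = bottom-count (IsMinLTD.isLTD S-min)
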